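{- Let $\mathcal{D}$ be a $(v,k,1)$-BIBD with $k\geq 4$. If $v\geq k+2$ and $3\leq h\leq k-1$, then the hypergraph $H_{\mathcal{D},h}$ is 2-e.c.
   Context: A $(v,k,\lambda)$-BIBD is a pair $\mathcal{D}=(V,\mathcal{B})$ where $V$ is a set of $v$ points and $\mathcal{B}$ is a collection of $k$-subsets of $V$ (blocks) such that every pair of distinct points lies in exactly $\lambda$ blocks. For $3\le h\le k$, $H_{\mathcal{D},h}$ is the $h$-uniform hypergraph with vertex set $V$ whose edges are all $h$-subsets of the blocks of $\mathcal{D}$ (for each block $B$, all $\binom{k}{h}$ $h$-subsets of $B$ are edges). An $h$-uniform hypergraph $H$ is $n$-e.c.\ if for every set $S\subseteq V(H)$ with $|S|=n$ and every $T\subseteq S$, there is $X\subseteq V(H)\setminus S$ with $|X|=h-1$ such that $X\cup\{z\}$ is an edge for every $z\in T$ and $X\cup\{s\}$ is not an edge for every $s\in S\setminus T$. -}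

module Defs where

open import Data.Nat using (ℕ; _∸_)
open import Data.Fin using (Fin)
open import Data.Fin.Subset using (Subset; _∈_; _∉_; _⊆_; _∪_; ⁅_⁆; ∣_∣)
open import Data.Fin.Subset.Properties using (_∈?_)
open import Data.List using (List; length; filter)
open import Data.List.Membership.Propositional using () renaming (_∈_ to _∈ₗ_)
open import Data.Product using (Σ; ∃; _×_)
open import Relation.Nullary using (¬_)
open import Relation.Nullary.Decidable using (_×-dec_)
open import Relation.Binary.PropositionalEquality using (_≡_)

pairCount : {v : ℕ} → List (Subset v) → Fin v → Fin v → ℕ
pairCount B x y = length (filter (λ b → (x ∈? b) ×-dec (y ∈? b)) B)

record BIBD (v k λ′ : ℕ) : Set where
  field
    blocks    : List (Subset v)
    blockSize : ∀ b → b ∈ₗ blocks → ∣ b ∣ ≡ k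
    balanced  : ∀ (x y : Fin v) → ¬ (x ≡ y) → pairCount blocks x y ≡ λ′

IsEdge : {v k λ′ : ℕ} → BIBD v k λ′ → (h : ℕ) → Subset v → Set
IsEdge D h E = ∣ E ∣ ≡ h × Σ (Subset _) (λ b → b ∈ₗ BIBD.blocks D × E ⊆ b)

IsNEC : {v : ℕ} → (n h : ℕ) → (Edge : Subset v → Set) → Set
IsNEC {v} n h Edge =
  ∀ (S T : Subset v) → ∣ S ∣ ≡ n → T ⊆ S →
  Σ (Subset v) λ X →
    ∣ X ∣ ≡ h ∸ 1
    × (∀ x → x ∈ X → x ∉ S)
    × (∀ z → z ∈ T → Edge (X ∪ ⁅ z ⁆))
    × (∀ s → s ∈ S → s ∉ T → ¬ Edge (X ∪ ⁅ s ⁆))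

-- Two points lie in exactly one block, so for S = {a, b} there is a block L with L ∩ S = T:
-- the block B through a and b if T = S, and otherwise the block through a point outside B and
-- one point of B (a, b or a third point), which meets B in that point only.  Any (h-1)-subset X
-- of L ∖ S then works: X ∪ {z} ⊆ L for z ∈ T, while a block containing X ∪ {s} shares two
-- points of X with L, hence is L, which misses s ∈ S ∖ T.
module Submission where

open import Defs
open import Data.Empty using (⊥-elim)
open import Data.Fin using (Fin; zero; suc)
open import Data.Fin.Subset
open import Data.Fin.Subset.Properties
  using (_∈?_; drop-there; drop-not-there; s⊆s; out⊆; ∣p∣≤∣x∷p∣; ⊥⊆; ∣⊥∣≡0; ∣⊤∣≡n; x∈⁅x⁆;
         x∈⁅y⁆⇒x≡y; x≢y⇒x∉⁅y⁆; ∣⁅x⁆∣≡1; p⊂q⇒∣p∣<∣q∣; x∈p∪q⁻; x∈p∪q⁺;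
         ∪-identityʳ; p─q⊆p)
open import Data.List using (List; []; _∷_; length)
open import Data.List.Membership.Propositional using () renaming (_∈_ to _∈ₗ_)
open import Data.List.Membership.Propositional.Properties using (∈-filter⁺; ∈-filter⁻)
open import Data.List.Relation.Unary.Any as Any using ()
open import Data.Nat using (ℕ; zero; suc; _≤_; _<_; _+_; _∸_; z≤n; s≤s)
open import Data.Nat.Properties
  using (≤-trans; ≤-<-trans; <-≤-trans; ≤-reflexive; <-irrefl; n≮n; n≤1+n; m<m+n; +-suc; +-cancelˡ-≤)
open import Data.Product using (∃; ∃₂; _×_; _,_)
open import Data.Sum using (_⊎_; inj₁; inj₂; [_,_]′)
open import Data.Bool.Properties using () renaming (_≟_ to _≟ᵇ_)
open import Data.Vec using ([]; _∷_; here; there)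
open import Data.Vec.Properties using (≡-dec)
open import Function using (_∘_; const)
open import Function.Bundles using (_⇔_; mk⇔; Equivalence)
open import Relation.Nullary using (¬_; Dec; yes; no; contradiction)
open import Relation.Nullary.Decidable using (_×-dec_)
open import Relation.Binary.PropositionalEquality using (_≡_; _≢_; refl; sym; trans; cong; subst; subst₂)

private variable
  n : ℕ
  x y : Fin n
  p q r : Subset n

∈∧∉⇒≢ : x ∈ p → y ∉ p → x ≢ y
∈∧∉⇒≢ {p = p} x∈p y∉p x≡y = y∉p (subst (_∈ p) x≡y x∈p)

∃x∈p∧x∉q-∷ : ∀ {s t} → (∃ λ x → x ∈ p × x ∉ q) → ∃ λ x → x ∈ s ∷ p × x ∉ t ∷ q
∃x∈p∧x∉q-∷ (x , x∈p , x∉q) = suc x , there x∈p , x∉q ∘ drop-there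

∣q∣<∣p∣⇒∃x∈p∧x∉q : ∀ (p q : Subset n) → ∣ q ∣ < ∣ p ∣ → ∃ λ x → x ∈ p × x ∉ q
∣q∣<∣p∣⇒∃x∈p∧x∉q []            []            ()
∣q∣<∣p∣⇒∃x∈p∧x∉q (inside  ∷ p) (outside ∷ q) _        = zero , here , λ ()
∣q∣<∣p∣⇒∃x∈p∧x∉q (inside  ∷ p) (inside  ∷ q) (s≤s lt) =
  ∃x∈p∧x∉q-∷ (∣q∣<∣p∣⇒∃x∈p∧x∉q p q lt)
∣q∣<∣p∣⇒∃x∈p∧x∉q (outside ∷ p) (s ∷ q)       lt       =
  ∃x∈p∧x∉q-∷ (∣q∣<∣p∣⇒∃x∈p∧x∉q p q (≤-<-trans (∣p∣≤∣x∷p∣ s q) lt))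

m≤∣p∣⇒∃q⊆p∧∣q∣≡m : ∀ m (p : Subset n) → m ≤ ∣ p ∣ → ∃ λ q → q ⊆ p × ∣ q ∣ ≡ m
m≤∣p∣⇒∃q⊆p∧∣q∣≡m {n} zero    p             _           = ⊥ , ⊥⊆ , ∣⊥∣≡0 n
m≤∣p∣⇒∃q⊆p∧∣q∣≡m (suc m) (inside  ∷ p) (s≤s m≤∣p∣) with m≤∣p∣⇒∃q⊆p∧∣q∣≡m m p m≤∣p∣
... | q , q⊆p , ∣q∣≡m = inside ∷ q , s⊆s q⊆p , cong suc ∣q∣≡m
m≤∣p∣⇒∃q⊆p∧∣q∣≡m (suc m) (outside ∷ p) m<∣p∣ with m≤∣p∣⇒∃q⊆p∧∣q∣≡m (suc m) p m<∣p∣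
... | q , q⊆p , ∣q∣≡m = outside ∷ q , out⊆ q⊆p , ∣q∣≡m

x∉p⇒∣p∪⁅x⁆∣≡1+∣p∣ : ∀ (p : Subset n) x → x ∉ p → ∣ p ∪ ⁅ x ⁆ ∣ ≡ suc ∣ p ∣
x∉p⇒∣p∪⁅x⁆∣≡1+∣p∣ (inside  ∷ p) zero    x∉p = contradiction here x∉p
x∉p⇒∣p∪⁅x⁆∣≡1+∣p∣ (outside ∷ p) zero    _   = cong (suc ∘ ∣_∣) (∪-identityʳ p)
x∉p⇒∣p∪⁅x⁆∣≡1+∣p∣ (inside  ∷ p) (suc x) x∉p = cong suc (x∉p⇒∣p∪⁅x⁆∣≡1+∣p∣ p x (drop-not-there x∉p))
x∉p⇒∣p∪⁅x⁆∣≡1+∣p∣ (outside ∷ p) (suc x) x∉p = x∉p⇒∣p∪⁅x⁆∣≡1+∣p∣ p x (drop-not-there x∉p)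

∣p∣≤∣q∣+∣p─q∣ : ∀ (p q : Subset n) → ∣ p ∣ ≤ ∣ q ∣ + ∣ p ─ q ∣
∣p∣≤∣q∣+∣p─q∣ []            []            = z≤n
∣p∣≤∣q∣+∣p─q∣ (inside  ∷ p) (inside  ∷ q) = s≤s (∣p∣≤∣q∣+∣p─q∣ p q)
∣p∣≤∣q∣+∣p─q∣ (inside  ∷ p) (outside ∷ q) =
  ≤-trans (s≤s (∣p∣≤∣q∣+∣p─q∣ p q)) (≤-reflexive (sym (+-suc ∣ q ∣ ∣ p ─ q ∣)))
∣p∣≤∣q∣+∣p─q∣ (outside ∷ p) (inside  ∷ q) = ≤-trans (∣p∣≤∣q∣+∣p─q∣ p q) (n≤1+n _)
∣p∣≤∣q∣+∣p─q∣ (outside ∷ p) (outside ∷ q) = ∣p∣≤∣q∣+∣p─q∣ p q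

x∈p─q⇒x∉q : ∀ (p q : Subset n) → x ∈ p ─ q → x ∉ q
x∈p─q⇒x∉q (inside ∷ p) (outside ∷ q) here          = λ ()
x∈p─q⇒x∉q (s ∷ p)      (inside  ∷ q) (there x∈p─q) = x∈p─q⇒x∉q p q x∈p─q ∘ drop-there
x∈p─q⇒x∉q (s ∷ p)      (outside ∷ q) (there x∈p─q) = x∈p─q⇒x∉q p q x∈p─q ∘ drop-there

∪-lub : p ⊆ r → q ⊆ r → p ∪ q ⊆ r
∪-lub {p = p} p⊆r q⊆r = [ p⊆r , q⊆r ]′ ∘ x∈p∪q⁻ p _

x∈p⇒⁅x⁆⊆p : x ∈ p → ⁅ x ⁆ ⊆ p
x∈p⇒⁅x⁆⊆p {x = x} {p = p} x∈p y∈⁅x⁆ = subst (_∈ p) (sym (x∈⁅y⁆⇒x≡y x y∈⁅x⁆)) x∈p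

2≤∣p∣⇒∃x≢y∈p : ∀ (p : Subset n) → 2 ≤ ∣ p ∣ → ∃₂ λ x y → x ≢ y × x ∈ p × y ∈ p
2≤∣p∣⇒∃x≢y∈p {n} p 2≤∣p∣ with ∣q∣<∣p∣⇒∃x∈p∧x∉q p ⊥ (subst (_< ∣ p ∣) (sym (∣⊥∣≡0 n)) (≤-trans (n≤1+n 1) 2≤∣p∣))
... | x , x∈p , _ with ∣q∣<∣p∣⇒∃x∈p∧x∉q p ⁅ x ⁆ (subst (_< ∣ p ∣) (sym (∣⁅x⁆∣≡1 x)) 2≤∣p∣)
... | y , y∈p , y∉⁅x⁆ = x , y , ∈∧∉⇒≢ (x∈⁅x⁆ x) y∉⁅x⁆ , x∈p , y∈p

-- a third point z would make ⁅ x ⁆ ∪ ⁅ y ⁆ a proper subset of p of the same size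
∣p∣≡2⇒∈-pair : ∣ p ∣ ≡ 2 → x ≢ y → x ∈ p → y ∈ p → ∀ {z} → z ∈ p → z ≡ x ⊎ z ≡ y
∣p∣≡2⇒∈-pair {p = p} {x = x} {y = y} ∣p∣≡2 x≢y x∈p y∈p {z} z∈p with z ∈? ⁅ x ⁆ ∪ ⁅ y ⁆
... | yes z∈xy = [ inj₁ ∘ x∈⁅y⁆⇒x≡y x , inj₂ ∘ x∈⁅y⁆⇒x≡y y ]′ (x∈p∪q⁻ ⁅ x ⁆ ⁅ y ⁆ z∈xy)
... | no  z∉xy = ⊥-elim (<-irrefl ∣xy∣≡2 (subst (∣ ⁅ x ⁆ ∪ ⁅ y ⁆ ∣ <_) ∣p∣≡2 xy<p))
  where
  xy<p : ∣ ⁅ x ⁆ ∪ ⁅ y ⁆ ∣ < ∣ p ∣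
  xy<p = p⊂q⇒∣p∣<∣q∣ (∪-lub (x∈p⇒⁅x⁆⊆p x∈p) (x∈p⇒⁅x⁆⊆p y∈p) , z , z∈p , z∉xy)
  ∣xy∣≡2 : ∣ ⁅ x ⁆ ∪ ⁅ y ⁆ ∣ ≡ 2
  ∣xy∣≡2 = trans (x∉p⇒∣p∪⁅x⁆∣≡1+∣p∣ ⁅ x ⁆ y (x≢y⇒x∉⁅y⁆ (x≢y ∘ sym))) (cong suc (∣⁅x⁆∣≡1 x))

module _ {A : Set} where

  1≤length⇒∃∈ : ∀ {xs : List A} → 1 ≤ length xs → ∃ λ x → x ∈ₗ xs
  1≤length⇒∃∈ {x ∷ _} _ = x , Any.here refl

  ∈∧∈∧≢⇒2≤length : ∀ {xs : List A} {x y} → x ∈ₗ xs → y ∈ₗ xs → x ≢ y → 2 ≤ length xs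
  ∈∧∈∧≢⇒2≤length (Any.here refl)  (Any.here refl)  x≢y = contradiction refl x≢y
  ∈∧∈∧≢⇒2≤length {_ ∷ _ ∷ _}       _                _                _   = s≤s (s≤s z≤n)
  ∈∧∈∧≢⇒2≤length {_ ∷ []} (Any.here refl)  (Any.there ())   _
  ∈∧∈∧≢⇒2≤length {_ ∷ []} (Any.there ())   _                _

contains-both? : (x y : Fin n) (b : Subset n) → Dec (x ∈ b × y ∈ b)
contains-both? x y b = (x ∈? b) ×-dec (y ∈? b)

Separates : Subset n → Subset n → Subset n → Set
Separates L S T = ∀ {x} → x ∈ S → x ∈ T ⇔ x ∈ L

both-∈ : x ∈ p → x ∈ q → x ∈ p ⇔ x ∈ q
both-∈ x∈p x∈q = mk⇔ (const x∈q) (const x∈p)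

both-∉ : x ∉ p → x ∉ q → x ∈ p ⇔ x ∈ q
both-∉ x∉p x∉q = mk⇔ (⊥-elim ∘ x∉p) (⊥-elim ∘ x∉q)

separates-pair : ∀ {S T L : Subset n} {a b} → (∀ {x} → x ∈ S → x ≡ a ⊎ x ≡ b) →
                 a ∈ T ⇔ a ∈ L → b ∈ T ⇔ b ∈ L → Separates L S T
separates-pair S⊆ab a-agrees b-agrees x∈S with S⊆ab x∈S
... | inj₁ refl = a-agrees
... | inj₂ refl = b-agrees

module _ {v k λ′ : ℕ} (D : BIBD v k (suc λ′)) where
  open BIBD D

  block-through : x ≢ y → ∃ λ b → b ∈ₗ blocks × x ∈ b × y ∈ b
  block-through {x = x} {y = y} x≢y
    with 1≤length⇒∃∈ (subst (1 ≤_) (sym (balanced x y x≢y)) (s≤s z≤n))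
  ... | b , b∈filter with ∈-filter⁻ (contains-both? x y) b∈filter
  ... | b∈blocks , x∈b , y∈b = b , b∈blocks , x∈b , y∈b

module _ {v k : ℕ} (D : BIBD v k 1) where
  open BIBD D

  block-unique : ∀ {b b′} → b ∈ₗ blocks → b′ ∈ₗ blocks → x ≢ y →
                 x ∈ b → y ∈ b → x ∈ b′ → y ∈ b′ → b ≡ b′
  block-unique {x = x} {y = y} {b} {b′} b∈blocks b′∈blocks x≢y x∈b y∈b x∈b′ y∈b′
    with ≡-dec _≟ᵇ_ b b′
  ... | yes b≡b′ = b≡b′
  ... | no  b≢b′ = contradiction (subst (2 ≤_) (balanced x y x≢y) (∈∧∈∧≢⇒2≤length
          (∈-filter⁺ (contains-both? x y) b∈blocks (x∈b , y∈b))
          (∈-filter⁺ (contains-both? x y) b′∈blocks (x∈b′ , y∈b′)) b≢b′)) (n≮n 1)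

  ∃-block-meeting-only-at : k < v → ∀ {B} → B ∈ₗ blocks → y ∈ B →
    ∃ λ L → L ∈ₗ blocks × y ∈ L × (∀ {x} → x ∈ B → x ≢ y → x ∉ L)
  ∃-block-meeting-only-at {y = y} k<v {B} B∈blocks y∈B
    with ∣q∣<∣p∣⇒∃x∈p∧x∉q ⊤ B (subst₂ _<_ (sym (blockSize B B∈blocks)) (sym (∣⊤∣≡n v)) k<v)
  ... | c , _ , c∉B with block-through D (∈∧∉⇒≢ y∈B c∉B)
  ... | L , L∈blocks , y∈L , c∈L = L , L∈blocks , y∈L , x∉L
    where
    x∉L : ∀ {x} → x ∈ B → x ≢ y → x ∉ L
    x∉L x∈B x≢y x∈L = c∉B (subst (c ∈_) (sym (block-unique B∈blocks L∈blocks x≢y x∈B y∈B x∈L y∈L)) c∈L)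

  ∃-block-agreeing-with : k < v → ∀ {B a b d} → B ∈ₗ blocks → a ∈ B → b ∈ B → d ∈ B →
    a ≢ b → a ≢ d → b ≢ d → ∀ T → ∃ λ L → L ∈ₗ blocks × (a ∈ T ⇔ a ∈ L) × (b ∈ T ⇔ b ∈ L)
  ∃-block-agreeing-with k<v {B} {a} {b} B∈blocks a∈B b∈B d∈B a≢b a≢d b≢d T with a ∈? T | b ∈? T
  ... | yes a∈T | yes b∈T = B , B∈blocks , both-∈ a∈T a∈B , both-∈ b∈T b∈B
  ... | yes a∈T | no  b∉T with ∃-block-meeting-only-at k<v B∈blocks a∈B
  ...   | L , L∈blocks , a∈L , only-a = L , L∈blocks , both-∈ a∈T a∈L , both-∉ b∉T (only-a b∈B (a≢b ∘ sym))
  ∃-block-agreeing-with k<v {B} {a} {b} B∈blocks a∈B b∈B d∈B a≢b a≢d b≢d T | no a∉T | yes b∈T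
    with ∃-block-meeting-only-at k<v B∈blocks b∈B
  ...   | L , L∈blocks , b∈L , only-b = L , L∈blocks , both-∉ a∉T (only-b a∈B a≢b) , both-∈ b∈T b∈L
  ∃-block-agreeing-with k<v {B} {a} {b} B∈blocks a∈B b∈B d∈B a≢b a≢d b≢d T | no a∉T | no b∉T
    with ∃-block-meeting-only-at k<v B∈blocks d∈B
  ...   | L , L∈blocks , _ , only-d = L , L∈blocks , both-∉ a∉T (only-d a∈B a≢d) , both-∉ b∉T (only-d b∈B b≢d)

  ∃-separating-block : k < v → 2 < k → ∀ S T → ∣ S ∣ ≡ 2 → ∃ λ L → L ∈ₗ blocks × Separates L S T
  ∃-separating-block k<v 2<k S T ∣S∣≡2
    with 2≤∣p∣⇒∃x≢y∈p S (≤-reflexive (sym ∣S∣≡2))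
  ... | a , b , a≢b , a∈S , b∈S with block-through D a≢b
  ... | B , B∈blocks , a∈B , b∈B
    with ∣q∣<∣p∣⇒∃x∈p∧x∉q B S (subst₂ _<_ (sym ∣S∣≡2) (sym (blockSize B B∈blocks)) 2<k)
  ... | d , d∈B , d∉S
    with ∃-block-agreeing-with k<v B∈blocks a∈B b∈B d∈B a≢b (∈∧∉⇒≢ a∈S d∉S) (∈∧∉⇒≢ b∈S d∉S) T
  ... | L , L∈blocks , a-agrees , b-agrees =
    L , L∈blocks , separates-pair (∣p∣≡2⇒∈-pair ∣S∣≡2 a≢b a∈S b∈S) a-agrees b-agrees

  m≤∣L─S∣ : ∀ {m L} S → L ∈ₗ blocks → ∣ S ∣ + m ≤ k → m ≤ ∣ L ─ S ∣
  m≤∣L─S∣ {L = L} S L∈blocks ∣S∣+m≤k =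
    +-cancelˡ-≤ ∣ S ∣ _ _ (≤-trans ∣S∣+m≤k
      (subst (_≤ ∣ S ∣ + ∣ L ─ S ∣) (blockSize L L∈blocks) (∣p∣≤∣q∣+∣p─q∣ L S)))

  module _ {m} {S T L X : Subset v} (L∈blocks : L ∈ₗ blocks) (L-separates : Separates L S T)
           (X⊆L─S : X ⊆ L ─ S) (∣X∣≡m : ∣ X ∣ ≡ m) where

    X-avoids-S : ∀ x → x ∈ X → x ∉ S
    X-avoids-S x x∈X = x∈p─q⇒x∉q L S (X⊆L─S x∈X)

    X∪⁅z⁆-edge : T ⊆ S → ∀ z → z ∈ T → IsEdge D (suc m) (X ∪ ⁅ z ⁆)
    X∪⁅z⁆-edge T⊆S z z∈T =
      trans (x∉p⇒∣p∪⁅x⁆∣≡1+∣p∣ X z (λ z∈X → X-avoids-S z z∈X (T⊆S z∈T))) (cong suc ∣X∣≡m) ,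
      L , L∈blocks , ∪-lub (p─q⊆p L S ∘ X⊆L─S) (x∈p⇒⁅x⁆⊆p (Equivalence.to (L-separates (T⊆S z∈T)) z∈T))

    X∪⁅s⁆-non-edge : 2 ≤ m → ∀ s → s ∈ S → s ∉ T → ¬ IsEdge D (suc m) (X ∪ ⁅ s ⁆)
    X∪⁅s⁆-non-edge 2≤m s s∈S s∉T (_ , B , B∈blocks , X∪s⊆B)
      with 2≤∣p∣⇒∃x≢y∈p X (subst (2 ≤_) (sym ∣X∣≡m) 2≤m)
    ... | c , d , c≢d , c∈X , d∈X = s∉T (Equivalence.from (L-separates s∈S) s∈L)
      where
      B≡L : B ≡ L
      B≡L = block-unique B∈blocks L∈blocks c≢d (X∪s⊆B (x∈p∪q⁺ (inj₁ c∈X))) (X∪s⊆B (x∈p∪q⁺ (inj₁ d∈X)))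
                         (p─q⊆p L S (X⊆L─S c∈X)) (p─q⊆p L S (X⊆L─S d∈X))
      s∈L : s ∈ L
      s∈L = subst (s ∈_) B≡L (X∪s⊆B (x∈p∪q⁺ (inj₂ (x∈⁅x⁆ s))))

  separating-blocks⇒IsNEC : ∀ {n m} → 2 ≤ m → n + m ≤ k →
    (∀ S T → ∣ S ∣ ≡ n → ∃ λ L → L ∈ₗ blocks × Separates L S T) →
    IsNEC n (suc m) (IsEdge D (suc m))
  separating-blocks⇒IsNEC {m = m} 2≤m n+m≤k separating S T ∣S∣≡n T⊆S with separating S T ∣S∣≡n
  ... | L , L∈blocks , L-separates
    with m≤∣p∣⇒∃q⊆p∧∣q∣≡m m (L ─ S) (m≤∣L─S∣ S L∈blocks (subst (λ n → n + m ≤ k) (sym ∣S∣≡n) n+m≤k))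
  ... | X , X⊆L─S , ∣X∣≡m =
    X , ∣X∣≡m , X-avoids-S L∈blocks L-separates X⊆L─S ∣X∣≡m ,
    X∪⁅z⁆-edge L∈blocks L-separates X⊆L─S ∣X∣≡m T⊆S ,
    X∪⁅s⁆-non-edge L∈blocks L-separates X⊆L─S ∣X∣≡m 2≤m

theorem9 : ∀ (v k h : ℕ) (D : BIBD v k 1) →
    4 ≤ k → k + 2 ≤ v → 3 ≤ h → h ≤ k ∸ 1 →
    IsNEC 2 h (IsEdge D h)
theorem9 v (suc k) (suc m) D 4≤k k+2≤v (s≤s 2≤m) 1+m≤k =
  separating-blocks⇒IsNEC D 2≤m (s≤s 1+m≤k) (∃-separating-block D k<v 2<k)
  where
  k<v : suc k < v
  k<v = <-≤-trans (m<m+n (suc k) (s≤s z≤n)) k+2≤v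
  2<k : 2 < suc k
  2<k = ≤-trans (n≤1+n 3) 4≤k
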